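{- Let $k \ge 2$ be an integer. (a) $m(k)$ is the minimum number $n$ such that there exists a $T_0$ topology on an $n$-point set having exactly $k$ open sets. (b) If $T(n,k) > 0$ for some $n$, then $T(n',k) > 0$ for all $n' > n$.
   Context: All sets are finite. A topology on a finite set $X$ is a collection of subsets of $X$ containing $\emptyset$ and $X$ and closed under unions and finite intersections; its members are the open sets. A $T_0$ topology is one in which for any two distinct points there is an open set containing exactly one of them. For integers $n \ge 1$, $k \ge 1$, $T(n,k)$ denotes the number of topologies on the set $\{1,\dots,n\}$ having exactly $k$ open sets. For an integer $k \ge 2$, $m(k)$ denotes the smallest positive integer $n$ such that there exists a topology on an $n$-point set having exactly $k$ open sets. -}

module Defs where

open import Data.Bool using (Bool; true; false)
open import Data.Nat using (ℕ; zero; suc; _≤_; _<_)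
open import Data.List using (List; []; _∷_; _++_; map; length; filterᵇ)
open import Data.Vec using (_∷_; [])
open import Data.Fin using (Fin)
open import Data.Fin.Subset using (Subset; ⊥; ⊤; _∪_; _∩_; _∈_; _∉_)
open import Data.Product using (Σ; ∃; _×_; _,_)
open import Data.Sum using (_⊎_)
open import Relation.Binary.PropositionalEquality using (_≡_; _≢_)

Collection : ℕ → Set
Collection n = Subset n → Bool

-- Topology: contains ∅ and X, closed under (binary, hence all finite =
-- all, since X is finite) unions and finite intersections.
record IsTopology {n : ℕ} (τ : Collection n) : Set where
  field
    has-∅ : τ ⊥ ≡ true
    has-X : τ ⊤ ≡ true
    ∪-closed : ∀ U V → τ U ≡ true → τ V ≡ true → τ (U ∪ V) ≡ true
    ∩-closed : ∀ U V → τ U ≡ true → τ V ≡ true → τ (U ∩ V) ≡ true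

IsT0 : {n : ℕ} → Collection n → Set
IsT0 {n} τ = ∀ (x y : Fin n) → x ≢ y →
  ∃ λ U → τ U ≡ true × ((x ∈ U × y ∉ U) ⊎ (y ∈ U × x ∉ U))

-- Enumeration of all 2^n subsets of Fin n (each exactly once).
allSubsets : (n : ℕ) → List (Subset n)
allSubsets zero = [] ∷ []
allSubsets (suc n) = map (true ∷_) (allSubsets n) ++ map (false ∷_) (allSubsets n)

numOpen : {n : ℕ} → Collection n → ℕ
numOpen {n} τ = length (filterᵇ τ (allSubsets n))

-- "T(n,k) > 0": some topology on {1..n} has exactly k open sets.
TPos : ℕ → ℕ → Set
TPos n k = ∃ λ (τ : Collection n) → IsTopology τ × numOpen τ ≡ k

T0Pos : ℕ → ℕ → Set
T0Pos n k = ∃ λ (τ : Collection n) → IsTopology τ × IsT0 τ × numOpen τ ≡ k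

IsLeastPos : (ℕ → Set) → ℕ → Set
IsLeastPos P n = 1 ≤ n × P n × (∀ n′ → 1 ≤ n′ → P n′ → n ≤ n′)

IsM : ℕ → ℕ → Set
IsM k n = IsLeastPos (λ n′ → TPos n′ k) n

module Submission where

-- If two distinct points x, y lie in exactly the same open sets, deleting y
-- gives a topology on one point fewer with as many open sets: an open set V
-- of the smaller space corresponds to V with y added exactly when x ∈ V.
-- Iterating, every topology with k open sets shrinks to a T0 topology with
-- k open sets on at most as many points, which gives (a).  Conversely,
-- doubling a point adds a point without changing the number of open sets,
-- which gives (b).

open import Defs
open import Data.Bool using (Bool; true; false; _∨_; _∧_; T?)
import Data.Bool.Properties as Bool
open import Data.Fin using (Fin; punchIn; punchOut) renaming (zero to fzero; suc to fsuc)
import Data.Fin.Properties as Fin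
open import Data.Fin.Subset using (Subset; _∈_; _∉_)
open import Data.Fin.Subset.Properties using (anySubset?)
open import Data.List using (List; []; _∷_; _++_; map; length; filterᵇ)
open import Data.List.Properties using (filter-++; length-++)
open import Data.Nat using (ℕ; zero; suc; _+_; _≤_; _<_; _≤′_; ≤′-refl; ≤′-step; z≤n; s≤s)
open import Data.Nat.Properties
  using (+-commutativeSemigroup; +-identityʳ; ≤-refl; ≤-trans; ≤-antisym; <⇒≤; ≤⇒≤′; ≤′⇒≤; m≤n⇒m≤1+n)
open import Algebra.Properties.CommutativeSemigroup +-commutativeSemigroup using (interchange)
open import Data.Product using (∃; _×_; _,_)
open import Data.Sum using (_⊎_; inj₁; inj₂)
open import Data.Vec using (Vec; []; _∷_; lookup; insertAt; replicate; zipWith)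
open import Data.Vec.Properties
  using (insertAt-punchIn; insertAt-lookup; lookup⇒[]=; []=⇒lookup; lookup-replicate; lookup-zipWith)
open import Function.Base using (_∘_)
open import Function.Bundles using (_⇔_; mk⇔)
open import Relation.Binary.PropositionalEquality
open import Relation.Nullary using (Dec; yes; no; ¬_; ¬?; contradiction)
open import Relation.Nullary.Decidable using (_×-dec_; _⊎-dec_; decidable-stable)

private
  variable
    m n k : ℕ

module _ {A : Set} (p : A → Bool) where

  length-filterᵇ-++ : (xs ys : List A) →
    length (filterᵇ p (xs ++ ys)) ≡ length (filterᵇ p xs) + length (filterᵇ p ys)
  length-filterᵇ-++ xs ys = trans (cong length (filter-++ (T? ∘ p) xs ys)) (length-++ (filterᵇ p xs))

  length-filterᵇ-none : (∀ x → p x ≡ false) → (xs : List A) → length (filterᵇ p xs) ≡ 0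
  length-filterᵇ-none p≡false [] = refl
  length-filterᵇ-none p≡false (x ∷ xs) rewrite p≡false x = length-filterᵇ-none p≡false xs

  length-filterᵇ-cong : ∀ {q : A → Bool} → (∀ x → p x ≡ q x) → (xs : List A) →
    length (filterᵇ p xs) ≡ length (filterᵇ q xs)
  length-filterᵇ-cong p≗q [] = refl
  length-filterᵇ-cong {q} p≗q (x ∷ xs) with p x | q x | p≗q x
  ... | true  | true  | _ = cong suc (length-filterᵇ-cong p≗q xs)
  ... | false | false | _ = length-filterᵇ-cong p≗q xs

length-filterᵇ-map : ∀ {A B : Set} (p : B → Bool) (f : A → B) (xs : List A) →
  length (filterᵇ p (map f xs)) ≡ length (filterᵇ (p ∘ f) xs)
length-filterᵇ-map p f [] = refl
length-filterᵇ-map p f (x ∷ xs) with p (f x)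
... | true  = cong suc (length-filterᵇ-map p f xs)
... | false = length-filterᵇ-map p f xs

numOpen-cong : {τ σ : Collection n} → (∀ U → τ U ≡ σ U) → numOpen τ ≡ numOpen σ
numOpen-cong {n} {τ} τ≗σ = length-filterᵇ-cong τ τ≗σ (allSubsets n)

numOpen-none : {τ : Collection n} → (∀ U → τ U ≡ false) → numOpen τ ≡ 0
numOpen-none {n} {τ} τ≗false = length-filterᵇ-none τ τ≗false (allSubsets n)

numOpen≤1 : (τ : Collection 0) → numOpen τ ≤ 1
numOpen≤1 τ with τ []
... | true  = s≤s z≤n
... | false = z≤n

numOpen-split-head : (τ : Collection (suc n)) →
  numOpen τ ≡ numOpen (τ ∘ (true ∷_)) + numOpen (τ ∘ (false ∷_))
numOpen-split-head {n} τ = begin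
  length (filterᵇ τ (map (true ∷_) (allSubsets n) ++ map (false ∷_) (allSubsets n)))
    ≡⟨ length-filterᵇ-++ τ (map (true ∷_) (allSubsets n)) (map (false ∷_) (allSubsets n)) ⟩
  length (filterᵇ τ (map (true ∷_) (allSubsets n))) + length (filterᵇ τ (map (false ∷_) (allSubsets n)))
    ≡⟨ cong₂ _+_ (length-filterᵇ-map τ (true ∷_) (allSubsets n))
                 (length-filterᵇ-map τ (false ∷_) (allSubsets n)) ⟩
  numOpen (τ ∘ (true ∷_)) + numOpen (τ ∘ (false ∷_)) ∎
  where open ≡-Reasoning

numOpen-split : (i : Fin (suc n)) (τ : Collection (suc n)) →
  numOpen τ ≡ numOpen (λ U → τ (insertAt U i true)) + numOpen (λ U → τ (insertAt U i false))
numOpen-split fzero τ = numOpen-split-head τ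
numOpen-split {suc n} (fsuc i) τ = begin
  numOpen τ
    ≡⟨ numOpen-split-head τ ⟩
  numOpen (τ ∘ (true ∷_)) + numOpen (τ ∘ (false ∷_))
    ≡⟨ cong₂ _+_ (numOpen-split i (τ ∘ (true ∷_))) (numOpen-split i (τ ∘ (false ∷_))) ⟩
  (N true true + N true false) + (N false true + N false false)
    ≡⟨ interchange (N true true) (N true false) (N false true) (N false false) ⟩
  (N true true + N false true) + (N true false + N false false)
    ≡⟨ sym (cong₂ _+_ (numOpen-split-head (λ U → τ (insertAt U (fsuc i) true)))
                      (numOpen-split-head (λ U → τ (insertAt U (fsuc i) false)))) ⟩
  numOpen (λ U → τ (insertAt U (fsuc i) true)) + numOpen (λ U → τ (insertAt U (fsuc i) false)) ∎
  where
  open ≡-Reasoning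
  N : Bool → Bool → ℕ
  N b c = numOpen (λ U → τ (b ∷ insertAt U i c))

IsTopology-preimage : (f : Subset m → Subset n) {τ : Collection n} →
  (∀ b → f (replicate m b) ≡ replicate n b) →
  (∀ g U V → f (zipWith g U V) ≡ zipWith g (f U) (f V)) →
  IsTopology τ → IsTopology (τ ∘ f)
IsTopology-preimage f {τ} f-replicate f-zipWith top = record
  { has-∅    = trans (cong τ (f-replicate false)) has-∅
  ; has-X    = trans (cong τ (f-replicate true)) has-X
  ; ∪-closed = λ U V U∈τ V∈τ → trans (cong τ (f-zipWith _∨_ U V)) (∪-closed (f U) (f V) U∈τ V∈τ)
  ; ∩-closed = λ U V U∈τ V∈τ → trans (cong τ (f-zipWith _∧_ U V)) (∩-closed (f U) (f V) U∈τ V∈τ)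
  }
  where open IsTopology top

insertAt-replicate : ∀ {A : Set} (i : Fin (suc n)) (b : A) → insertAt (replicate n b) i b ≡ replicate (suc n) b
insertAt-replicate fzero b = refl
insertAt-replicate {suc n} (fsuc i) b = cong (b ∷_) (insertAt-replicate i b)

insertAt-zipWith : ∀ {A : Set} (g : A → A → A) (i : Fin (suc n)) (U V : Vec A n) (a b : A) →
  insertAt (zipWith g U V) i (g a b) ≡ zipWith g (insertAt U i a) (insertAt V i b)
insertAt-zipWith g fzero U V a b = refl
insertAt-zipWith g (fsuc i) (u ∷ U) (v ∷ V) a b = cong (g u v ∷_) (insertAt-zipWith g i U V a b)

Indistinguishable : Collection n → Fin n → Fin n → Set
Indistinguishable τ x y = ∀ U → τ U ≡ true → lookup U x ≡ lookup U y

-- Removing the point y, whose role is taken over by x.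
module Identify {x y : Fin (suc (suc n))} (x≢y : x ≢ y) where

  x′ : Fin (suc n)
  x′ = punchOut (x≢y ∘ sym)

  copy : Subset (suc n) → Subset (suc (suc n))
  copy V = insertAt V y (lookup V x′)

  identify : Collection (suc (suc n)) → Collection (suc n)
  identify τ = τ ∘ copy

  lookup-insertAt-x : (V : Subset (suc n)) (b : Bool) → lookup (insertAt V y b) x ≡ lookup V x′
  lookup-insertAt-x V b = begin
    lookup (insertAt V y b) x               ≡⟨ cong (lookup (insertAt V y b)) (sym (Fin.punchIn-punchOut (x≢y ∘ sym))) ⟩
    lookup (insertAt V y b) (punchIn y x′) ≡⟨ insertAt-punchIn V y b x′ ⟩
    lookup V x′                             ∎
    where open ≡-Reasoning

  copy-replicate : ∀ b → copy (replicate (suc n) b) ≡ replicate (suc (suc n)) b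
  copy-replicate b = trans (cong (insertAt _ y) (lookup-replicate x′ b)) (insertAt-replicate y b)

  copy-zipWith : ∀ g U V → copy (zipWith g U V) ≡ zipWith g (copy U) (copy V)
  copy-zipWith g U V = trans (cong (insertAt _ y) (lookup-zipWith g x′ U V))
                             (insertAt-zipWith g y U V (lookup U x′) (lookup V x′))

  identify-isTopology : {τ : Collection (suc (suc n))} → IsTopology τ → IsTopology (identify τ)
  identify-isTopology = IsTopology-preimage copy copy-replicate copy-zipWith

  numOpen-identify : {τ : Collection (suc (suc n))} → Indistinguishable τ x y →
    numOpen (identify τ) ≡ numOpen τ
  numOpen-identify {τ} x~y = begin
    numOpen (identify τ)
      ≡⟨ numOpen-split x′ (identify τ) ⟩
    numOpen (λ W → τ (copy (insertAt W x′ true))) + numOpen (λ W → τ (copy (insertAt W x′ false)))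
      ≡⟨ cong₂ _+_ (numOpen-cong (λ W → cong (τ ∘ insertAt _ y) (insertAt-lookup W x′ true)))
                   (numOpen-cong (λ W → cong (τ ∘ insertAt _ y) (insertAt-lookup W x′ false))) ⟩
    N true true + N false false
      ≡⟨ cong₂ _+_ (trans (sym (+-identityʳ (N true true))) (cong (N true true +_) (sym (N-mixed false true λ ()))))
                   (cong (_+ N false false) (sym (N-mixed true false λ ()))) ⟩
    (N true true + N false true) + (N true false + N false false)
      ≡⟨ sym (cong₂ _+_ (numOpen-split x′ (λ V → τ (insertAt V y true)))
                        (numOpen-split x′ (λ V → τ (insertAt V y false)))) ⟩
    numOpen (λ V → τ (insertAt V y true)) + numOpen (λ V → τ (insertAt V y false))
      ≡⟨ sym (numOpen-split y τ) ⟩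
    numOpen τ ∎
    where
    open ≡-Reasoning
    N : Bool → Bool → ℕ
    N c b = numOpen (λ W → τ (insertAt (insertAt W x′ c) y b))

    -- no open set contains exactly one of x and y
    N-mixed : ∀ c b → c ≢ b → N c b ≡ 0
    N-mixed c b c≢b = numOpen-none λ W → Bool.¬-not λ open? →
      c≢b (begin
        c                                              ≡⟨ sym (insertAt-lookup W x′ c) ⟩
        lookup (insertAt W x′ c) x′                    ≡⟨ sym (lookup-insertAt-x (insertAt W x′ c) b) ⟩
        lookup (insertAt (insertAt W x′ c) y b) x      ≡⟨ x~y _ open? ⟩
        lookup (insertAt (insertAt W x′ c) y b) y      ≡⟨ insertAt-lookup (insertAt W x′ c) y b ⟩
        b                                              ∎)

  identify-TPos : {τ : Collection (suc (suc n))} →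
    IsTopology τ → Indistinguishable τ x y → numOpen τ ≡ k → TPos (suc n) k
  identify-TPos {τ = τ} top x~y count = identify τ , identify-isTopology top , trans (numOpen-identify x~y) count

lookup-≢⇒separates : {x y : Fin n} (U : Subset n) → lookup U x ≢ lookup U y →
  (x ∈ U × y ∉ U) ⊎ (y ∈ U × x ∉ U)
lookup-≢⇒separates {x = x} {y} U Ux≢Uy with lookup U x in Ux | lookup U y in Uy
... | true  | true  = contradiction refl Ux≢Uy
... | false | false = contradiction refl Ux≢Uy
... | true  | false = inj₁ (lookup⇒[]= x U Ux , λ y∈U → contradiction (trans (sym ([]=⇒lookup y∈U)) Uy) λ ())
... | false | true  = inj₂ (lookup⇒[]= y U Uy , λ x∈U → contradiction (trans (sym ([]=⇒lookup x∈U)) Ux) λ ())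

Separated : Collection n → Fin n → Fin n → Set
Separated τ x y = ∃ λ U → τ U ≡ true × lookup U x ≢ lookup U y

separated? : (τ : Collection n) (x y : Fin n) → Dec (Separated τ x y)
separated? τ x y = anySubset? λ U → (τ U Bool.≟ true) ×-dec ¬? (lookup U x Bool.≟ lookup U y)

¬separated⇒indistinguishable : {τ : Collection n} {x y : Fin n} →
  ¬ Separated τ x y → Indistinguishable τ x y
¬separated⇒indistinguishable {x = x} {y} ¬sep U U∈τ =
  decidable-stable (lookup U x Bool.≟ lookup U y) λ Ux≢Uy → ¬sep (U , U∈τ , Ux≢Uy)

equal-or-separated? : (τ : Collection n) (x y : Fin n) → Dec (x ≡ y ⊎ Separated τ x y)
equal-or-separated? τ x y = (x Fin.≟ y) ⊎-dec separated? τ x y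

IsT0-or-indistinguishable : (τ : Collection n) →
  IsT0 τ ⊎ ∃ λ x → ∃ λ y → x ≢ y × Indistinguishable τ x y
IsT0-or-indistinguishable {n} τ with Fin.all? (λ x → Fin.all? (equal-or-separated? τ x))
... | yes all-separated = inj₁ λ x y x≢y → separation (all-separated x y) x≢y
  where
  separation : ∀ {x y} → x ≡ y ⊎ Separated τ x y → x ≢ y →
    ∃ λ U → τ U ≡ true × ((x ∈ U × y ∉ U) ⊎ (y ∈ U × x ∉ U))
  separation (inj₁ x≡y)               x≢y = contradiction x≡y x≢y
  separation (inj₂ (U , U∈τ , Ux≢Uy)) _   = U , U∈τ , lookup-≢⇒separates U Ux≢Uy
... | no ¬all-separated
  with x , ¬all-separated-x ← Fin.¬∀⟶∃¬ n _ (λ x → Fin.all? (equal-or-separated? τ x)) ¬all-separated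
  with y , ¬equal-or-separated ← Fin.¬∀⟶∃¬ n _ (equal-or-separated? τ x) ¬all-separated-x
  = inj₂ (x , y , ¬equal-or-separated ∘ inj₁ , ¬separated⇒indistinguishable (¬equal-or-separated ∘ inj₂))

T0Pos⇒TPos : T0Pos n k → TPos n k
T0Pos⇒TPos (τ , top , _ , count) = τ , top , count

TPos-positive : 2 ≤ k → TPos n k → 1 ≤ n
TPos-positive {n = zero}  2≤k (τ , _ , count) =
  contradiction (≤-trans 2≤k (subst (_≤ 1) count (numOpen≤1 τ))) λ { (s≤s ()) }
TPos-positive {n = suc n} _   _ = s≤s z≤n

T0-reduction : TPos n k → ∃ λ n′ → n′ ≤ n × T0Pos n′ k
T0-reduction {n} (τ , top , count) with IsT0-or-indistinguishable τ
... | inj₁ t0 = n , ≤-refl , τ , top , t0 , count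
T0-reduction {suc zero} _ | inj₂ (fzero , fzero , x≢y , _) = contradiction refl x≢y
T0-reduction {suc (suc n)} (τ , top , count) | inj₂ (x , y , x≢y , x~y)
  with n′ , n′≤n , t0 ← T0-reduction (Identify.identify-TPos x≢y top x~y count)
  = n′ , m≤n⇒m≤1+n n′≤n , t0

double : Collection (suc n) → Collection (suc (suc n))
double σ (true  ∷ true  ∷ U) = σ (true ∷ U)
double σ (false ∷ false ∷ U) = σ (false ∷ U)
double σ (_     ∷ _     ∷ _) = false

module _ (σ : Collection (suc n)) where

  double-diagonal : ∀ b U → double σ (b ∷ b ∷ U) ≡ σ (b ∷ U)
  double-diagonal true  U = refl
  double-diagonal false U = refl

  double-agrees : ∀ {b c U} → double σ (b ∷ c ∷ U) ≡ true → b ≡ c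
  double-agrees {true}  {true}  _ = refl
  double-agrees {false} {false} _ = refl

  double-zipWith-closed : (g : Bool → Bool → Bool) →
    (∀ U V → σ U ≡ true → σ V ≡ true → σ (zipWith g U V) ≡ true) →
    ∀ U V → double σ U ≡ true → double σ V ≡ true → double σ (zipWith g U V) ≡ true
  double-zipWith-closed g closed (b ∷ c ∷ U) (d ∷ e ∷ V) U∈ V∈
    with refl ← double-agrees {b} {c} {U} U∈ | refl ← double-agrees {d} {e} {V} V∈ =
    trans (double-diagonal (g b d) (zipWith g U V))
          (closed (b ∷ U) (d ∷ V) (trans (sym (double-diagonal b U)) U∈) (trans (sym (double-diagonal d V)) V∈))

  double-isTopology : IsTopology σ → IsTopology (double σ)
  double-isTopology top = record
    { has-∅    = has-∅
    ; has-X    = has-X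
    ; ∪-closed = double-zipWith-closed _∨_ ∪-closed
    ; ∩-closed = double-zipWith-closed _∧_ ∩-closed
    }
    where open IsTopology top

  numOpen-double : numOpen (double σ) ≡ numOpen σ
  numOpen-double = begin
    numOpen (double σ)            ≡⟨ sym (numOpen-identify double-indistinguishable) ⟩
    numOpen (identify (double σ)) ≡⟨ numOpen-cong {τ = identify (double σ)} (λ { (c ∷ U) → double-diagonal c U }) ⟩
    numOpen σ                     ∎
    where
    open ≡-Reasoning
    -- here copy (c ∷ U) reduces to c ∷ c ∷ U
    open Identify {x = fsuc fzero} {y = fzero} (λ ())
    double-indistinguishable : Indistinguishable (double σ) (fsuc fzero) fzero
    double-indistinguishable (b ∷ c ∷ U) U∈ = sym (double-agrees {b} {c} {U} U∈)

TPos-suc : 1 ≤ n → TPos n k → TPos (suc n) k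
TPos-suc {suc n} _ (σ , top , count) = double σ , double-isTopology σ top , trans (numOpen-double σ) count

TPos-mono : ∀ {n′} → 1 ≤ n → TPos n k → n ≤′ n′ → TPos n′ k
TPos-mono 1≤n t ≤′-refl           = t
TPos-mono 1≤n t (≤′-step n≤′n′) = TPos-suc (≤-trans 1≤n (≤′⇒≤ n≤′n′)) (TPos-mono 1≤n t n≤′n′)

IsLeastPos-⇔ : {P Q : ℕ → Set} → (∀ {n} → P n → Q n) →
  (∀ {n} → Q n → ∃ λ n′ → 1 ≤ n′ × n′ ≤ n × P n′) →
  ∀ n → IsLeastPos Q n ⇔ IsLeastPos P n
IsLeastPos-⇔ {P} {Q} P⇒Q shrink n = mk⇔ to from
  where
  to : IsLeastPos Q n → IsLeastPos P n
  to (1≤n , Qn , least) with n′ , 1≤n′ , n′≤n , Pn′ ← shrink Qn =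
    1≤n , subst P (≤-antisym n′≤n (least n′ 1≤n′ (P⇒Q Pn′))) Pn′ , λ n″ 1≤n″ → least n″ 1≤n″ ∘ P⇒Q

  from : IsLeastPos P n → IsLeastPos Q n
  from (1≤n , Pn , least) = 1≤n , P⇒Q Pn , bound
    where
    bound : ∀ n″ → 1 ≤ n″ → Q n″ → n ≤ n″
    bound n″ _ Qn″ with n′ , 1≤n′ , n′≤n″ , Pn′ ← shrink Qn″ = ≤-trans (least n′ 1≤n′ Pn′) n′≤n″

lemma2p6 : (k : ℕ) → 2 ≤ k →
    (∀ n → IsM k n ⇔ IsLeastPos (λ n′ → T0Pos n′ k) n)
    × (∀ n → 1 ≤ n → TPos n k → ∀ n′ → n < n′ → TPos n′ k)
lemma2p6 k 2≤k =
  IsLeastPos-⇔ T0Pos⇒TPos shrink-to-T0 ,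
  λ n 1≤n t n′ n<n′ → TPos-mono 1≤n t (≤⇒≤′ (<⇒≤ n<n′))
  where
  shrink-to-T0 : ∀ {n} → TPos n k → ∃ λ n′ → 1 ≤ n′ × n′ ≤ n × T0Pos n′ k
  shrink-to-T0 t with n′ , n′≤n , t0 ← T0-reduction t =
    n′ , TPos-positive 2≤k (T0Pos⇒TPos t0) , n′≤n , t0
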